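{- Define polynomials $p_n(x,y,z)$ by \[ \sum_{n=0}^\infty p_n(x,y,z)q^n=\prod_{j=0}^\infty\left(1+xq^{2^j}\right)\left(1+yq^{2^j}+zq^{2\cdot 2^j}\right), \] and for $n\ge1$ let $\widetilde{Q}_n(z)=z^{ -n}p_{2^{n+1}-2}(z,z,z)=\sum_{j=0}^{n}a_j^{(n)}z^j$ (this is a polynomial of degree $n$). Then for $n\ge 1$ and $0\le j\le n$, $a_j^{(n)}$ equals the number of $2$-restricted binary overpartitions $\beta$ of $2^{n+1}-2$ with $S(\beta)=n+j$.
   Context: A binary overpartition of a positive integer $n$ is a non-increasing sequence of nonnegative integer powers of $2$ with sum $n$, in which the first occurrence of each power of $2$ may be overlined. It is $2$-restricted if each power of $2$ occurs at most $2$ times as a non-overlined part. For such $\beta$, $S(\beta)$ is the sum of: the number of overlined parts of $\beta$ (these are distinct), the number of distinct powers of $2$ that occur exactly once as a non-overlined part, and the number of distinct powers of $2$ that occur (exactly) twice as a non-overlined part. -}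

module Defs where

open import Data.Nat using (ℕ; zero; suc; _+_; _*_; _∸_; _^_; _≟_; _≡ᵇ_)
open import Data.Bool using (Bool; true; false; if_then_else_; _∧_)
open import Data.Fin using (Fin; toℕ) renaming (zero to fz; suc to fs)
open import Data.Product using (_×_; _,_)
open import Data.List using (List; []; _∷_; length; filter; map; concatMap)
open import Data.Vec using (Vec; []; _∷_)
open import Relation.Nullary.Decidable using (_×-dec_)
open import Relation.Binary.PropositionalEquality using (_≡_)

-- A formal power series in q with polynomial coefficients in x, y, z
-- (all coefficients in ℕ) is given by its coefficient function
--   F m a b c  =  coefficient of  q^m x^a y^b z^c.

Ser : Set
Ser = ℕ → ℕ → ℕ → ℕ → ℕ

sumTo : ℕ → (ℕ → ℕ) → ℕ
sumTo zero    f = f 0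
sumTo (suc n) f = sumTo n f + f (suc n)

_⊛_ : Ser → Ser → Ser
(F ⊛ G) m a b c =
  sumTo m λ m₁ → sumTo a λ a₁ → sumTo b λ b₁ → sumTo c λ c₁ →
    F m₁ a₁ b₁ c₁ * G (m ∸ m₁) (a ∸ a₁) (b ∸ b₁) (c ∸ c₁)

infixl 7 _⊛_
infixl 6 _⊕_

_⊕_ : Ser → Ser → Ser
(F ⊕ G) m a b c = F m a b c + G m a b c

mono : ℕ → ℕ → ℕ → ℕ → Ser
mono m a b c m' a' b' c' =
  if (m ≡ᵇ m') ∧ (a ≡ᵇ a') ∧ (b ≡ᵇ b') ∧ (c ≡ᵇ c') then 1 else 0

oneS : Ser
oneS = mono 0 0 0 0

factor : ℕ → Ser
factor j = (oneS ⊕ mono (2 ^ j) 1 0 0)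
         ⊛ (oneS ⊕ mono (2 ^ j) 0 1 0 ⊕ mono (2 * 2 ^ j) 0 0 1)

prodTo : ℕ → Ser
prodTo zero    = oneS
prodTo (suc N) = prodTo N ⊛ factor N

-- Every factor with j ≥ m+1
-- has 2^j > m, hence is 1 + O(q^{m+1}); so the coefficient of q^m of
-- the infinite product equals that of the finite product over j < m+1.
pCoeff : ℕ → ℕ → ℕ → ℕ → ℕ
pCoeff m a b c = prodTo (suc m) m a b c

pDiag : ℕ → ℕ → ℕ
pDiag m k = sumTo k λ a → sumTo (k ∸ a) λ b → pCoeff m a b (k ∸ a ∸ b)

-- a_j^{(n)} = coefficient of z^j in z^{-n} p_{2^{n+1}-2}(z,z,z)
--           = coefficient of z^{n+j} in p_{2^{n+1}-2}(z,z,z)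
aCoeff : ℕ → ℕ → ℕ
aCoeff n j = pDiag (2 ^ suc n ∸ 2) (n + j)

-- A 2-restricted binary overpartition is encoded by its multiplicity data:
-- position i of the vector describes the power 2^i by a pair (o , c) where
-- o = true iff an overlined 2^i occurs, and c ∈ {0,1,2} is the number of
-- non-overlined parts equal to 2^i.  Parts of a partition of N are ≤ N,
-- so powers 2^i with i < N+1 suffice.

Choice : Set
Choice = Bool × Fin 3

allChoices : List Choice
allChoices = (false , fz) ∷ (false , fs fz) ∷ (false , fs (fs fz))
           ∷ (true  , fz) ∷ (true  , fs fz) ∷ (true  , fs (fs fz)) ∷ []

allVecs : (L : ℕ) → List (Vec Choice L)
allVecs zero    = [] ∷ []
allVecs (suc L) = concatMap (λ ch → map (ch ∷_) (allVecs L)) allChoices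

b2n : Bool → ℕ
b2n true  = 1
b2n false = 0

weightFrom : ℕ → {L : ℕ} → Vec Choice L → ℕ
weightFrom i []             = 0
weightFrom i ((o , c) ∷ v)  = (b2n o + toℕ c) * 2 ^ i + weightFrom (suc i) v

weight : {L : ℕ} → Vec Choice L → ℕ
weight = weightFrom 0

occurs : Fin 3 → ℕ
occurs fz      = 0
occurs (fs _)  = 1

Sstat : {L : ℕ} → Vec Choice L → ℕ
Sstat []             = 0
Sstat ((o , c) ∷ v)  = b2n o + occurs c + Sstat v

countOP : ℕ → ℕ → ℕ
countOP N k =
  length (filter (λ v → (weight v ≟ N) ×-dec (Sstat v ≟ k)) (allVecs (suc N)))

-- Expanding the product, every term of p_m(x,y,z) q^m is obtained by choosing, for each j,
-- one of the six monomials of the j-th factor; the choice (o, c) ∈ {0,1} × {0,1,2} contributes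
-- q^{(o+c)·2^j}, an x if o = 1, a y if c = 1 and a z if c = 2. So a choice sequence is exactly a
-- 2-restricted binary overpartition of m, and its total degree in x, y, z is S(β). Hence the
-- coefficient of z^k in p_m(z,z,z) counts the overpartitions of m with S(β) = k, for all m and k.
module Submission where

open import Defs
open import Data.Nat using (ℕ; zero; suc; _+_; _*_; _∸_; _^_; _≤_; _≡ᵇ_; _≤ᵇ_; _≟_)
open import Data.Nat.Properties
open import Data.Bool using (true; false; if_then_else_; _∧_; T)
open import Data.Fin using (Fin; toℕ) renaming (zero to fzero; suc to fsuc)
open import Data.List using (List; []; _∷_; _++_; map; concatMap; length; filter)
open import Data.List.Properties
  using (map-++; map-∘; map-cong; ++-identityʳ; map-concatMap; concatMap-map; concatMap-cong; concatMap-++)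
open import Data.Vec using (Vec; []; _∷_)
open import Data.Product using (_,_)
open import Function using (_∘_)
open import Relation.Nullary using (does; _×-dec_)
open import Relation.Unary using (Decidable)
open import Relation.Binary.PropositionalEquality
open import Algebra.Properties.CommutativeSemigroup *-commutativeSemigroup
  using () renaming (interchange to *-interchange)
open import Algebra.Properties.CommutativeSemigroup +-commutativeSemigroup
  using () renaming (interchange to +-interchange)
open ≡-Reasoning

b2n-if : ∀ b → (if b then 1 else 0) ≡ b2n b
b2n-if true  = refl
b2n-if false = refl

b2n-∧ : ∀ x y → b2n (x ∧ y) ≡ b2n x * b2n y
b2n-∧ false y = refl
b2n-∧ true  y = sym (+-identityʳ (b2n y))

≤ᵇ-suc : ∀ p m → (suc p ≤ᵇ suc m) ≡ (p ≤ᵇ m)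
≤ᵇ-suc zero    m = refl
≤ᵇ-suc (suc p) m = refl

b2n-≤ᵇ-suc : ∀ t n → b2n (t ≤ᵇ suc n) ≡ b2n (t ≤ᵇ n) + b2n (t ≡ᵇ suc n)
b2n-≤ᵇ-suc zero          n       = refl
b2n-≤ᵇ-suc (suc zero)    zero    = refl
b2n-≤ᵇ-suc (suc (suc t)) zero    = refl
b2n-≤ᵇ-suc (suc t)       (suc n) rewrite ≤ᵇ-suc t (suc n) | ≤ᵇ-suc t n = b2n-≤ᵇ-suc t n

b2n-+≡ᵇ : ∀ p p′ m → b2n (p + p′ ≡ᵇ m) ≡ b2n (p ≤ᵇ m) * b2n (p′ ≡ᵇ m ∸ p)
b2n-+≡ᵇ zero    p′ m       = sym (+-identityʳ _)
b2n-+≡ᵇ (suc p) p′ zero    = refl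
b2n-+≡ᵇ (suc p) p′ (suc m) rewrite ≤ᵇ-suc p m = b2n-+≡ᵇ p p′ m

b2n-≡ᵇ-subst : ∀ t k (f : ℕ → ℕ) → b2n (t ≡ᵇ k) * f k ≡ b2n (t ≡ᵇ k) * f t
b2n-≡ᵇ-subst t k f with t ≡ᵇ k in eq
... | false = refl
... | true  rewrite ≡ᵇ⇒≡ t k (subst T (sym eq) _) = refl

*-assoc₅ : ∀ x y z w g → (x * (y * (z * w))) * g ≡ x * (y * (z * (w * g)))
*-assoc₅ x y z w g = begin
  (x * (y * (z * w))) * g   ≡⟨ *-assoc x _ g ⟩
  x * ((y * (z * w)) * g)   ≡⟨ cong (x *_) (*-assoc y _ g) ⟩
  x * (y * ((z * w) * g))   ≡⟨ cong (λ u → x * (y * u)) (*-assoc z w g) ⟩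
  x * (y * (z * (w * g)))   ∎

sumTo-cong : ∀ n {f g : ℕ → ℕ} → (∀ i → f i ≡ g i) → sumTo n f ≡ sumTo n g
sumTo-cong zero    e = e 0
sumTo-cong (suc n) e = cong₂ _+_ (sumTo-cong n e) (e (suc n))

sumTo-+ : ∀ n (f g : ℕ → ℕ) → sumTo n (λ i → f i + g i) ≡ sumTo n f + sumTo n g
sumTo-+ zero    f g = refl
sumTo-+ (suc n) f g = trans (cong (_+ (f (suc n) + g (suc n))) (sumTo-+ n f g))
                            (+-interchange (sumTo n f) (sumTo n g) (f (suc n)) (g (suc n)))

sumTo-zero : ∀ n → sumTo n (λ _ → 0) ≡ 0
sumTo-zero zero    = refl
sumTo-zero (suc n) = cong (_+ 0) (sumTo-zero n)

sumTo-*ˡ : ∀ n k (f : ℕ → ℕ) → sumTo n (λ i → k * f i) ≡ k * sumTo n f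
sumTo-*ˡ zero    k f = refl
sumTo-*ˡ (suc n) k f = trans (cong (_+ k * f (suc n)) (sumTo-*ˡ n k f))
                             (sym (*-distribˡ-+ k (sumTo n f) (f (suc n))))

sumTo-scale : ∀ n k {f : ℕ → ℕ} {s} → sumTo n f ≡ s → sumTo n (λ i → k * f i) ≡ k * s
sumTo-scale n k {f} e = trans (sumTo-*ˡ n k f) (cong (k *_) e)

sumTo-sift : ∀ n t (f : ℕ → ℕ) → sumTo n (λ i → b2n (t ≡ᵇ i) * f i) ≡ b2n (t ≤ᵇ n) * f t
sumTo-sift zero    zero    f = refl
sumTo-sift zero    (suc t) f = refl
sumTo-sift (suc n) t       f = begin
  sumTo n (λ i → b2n (t ≡ᵇ i) * f i) + b2n (t ≡ᵇ suc n) * f (suc n)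
    ≡⟨ cong₂ _+_ (sumTo-sift n t f) (b2n-≡ᵇ-subst t (suc n) f) ⟩
  b2n (t ≤ᵇ n) * f t + b2n (t ≡ᵇ suc n) * f t
    ≡⟨ sym (*-distribʳ-+ (f t) (b2n (t ≤ᵇ n)) _) ⟩
  (b2n (t ≤ᵇ n) + b2n (t ≡ᵇ suc n)) * f t
    ≡⟨ cong (_* f t) (sym (b2n-≤ᵇ-suc t n)) ⟩
  b2n (t ≤ᵇ suc n) * f t
    ∎

infix 4 _≗ˢ_
_≗ˢ_ : Ser → Ser → Set
F ≗ˢ G = ∀ m a b c → F m a b c ≡ G m a b c

≗ˢ-sym : ∀ {F G} → F ≗ˢ G → G ≗ˢ F
≗ˢ-sym e m a b c = sym (e m a b c)

≗ˢ-trans : ∀ {F G H} → F ≗ˢ G → G ≗ˢ H → F ≗ˢ H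
≗ˢ-trans e e′ m a b c = trans (e m a b c) (e′ m a b c)

zeroˢ : Ser
zeroˢ _ _ _ _ = 0

⊛-cong : ∀ {F F′ G G′} → F ≗ˢ F′ → G ≗ˢ G′ → F ⊛ G ≗ˢ F′ ⊛ G′
⊛-cong eF eG m a b c =
  sumTo-cong m λ m₁ → sumTo-cong a λ a₁ → sumTo-cong b λ b₁ → sumTo-cong c λ c₁ →
    cong₂ _*_ (eF m₁ a₁ b₁ c₁) (eG _ _ _ _)

⊛-distribʳ-⊕ : ∀ F F′ G → (F ⊕ F′) ⊛ G ≗ˢ F ⊛ G ⊕ F′ ⊛ G
⊛-distribʳ-⊕ F F′ G m a b c =
  trans (sumTo-cong m λ m₁ → trans (sumTo-cong a λ a₁ → trans (sumTo-cong b λ b₁ →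
          trans (sumTo-cong c λ c₁ →
                   *-distribʳ-+ (G (m ∸ m₁) (a ∸ a₁) (b ∸ b₁) (c ∸ c₁)) (F m₁ a₁ b₁ c₁) (F′ m₁ a₁ b₁ c₁))
            (sumTo-+ c _ _)) (sumTo-+ b _ _)) (sumTo-+ a _ _)) (sumTo-+ m _ _)

⊛-zeroˡ : ∀ G → zeroˢ ⊛ G ≗ˢ zeroˢ
⊛-zeroˡ G m a b c =
  trans (sumTo-cong m λ _ → trans (sumTo-cong a λ _ → trans (sumTo-cong b λ _ → sumTo-zero c)
    (sumTo-zero b)) (sumTo-zero a)) (sumTo-zero m)

mono-b2n : ∀ p s t u m a b c →
  mono p s t u m a b c ≡ b2n (p ≡ᵇ m) * (b2n (s ≡ᵇ a) * (b2n (t ≡ᵇ b) * b2n (u ≡ᵇ c)))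
mono-b2n p s t u m a b c = begin
  mono p s t u m a b c
    ≡⟨ b2n-if ((p ≡ᵇ m) ∧ (s ≡ᵇ a) ∧ (t ≡ᵇ b) ∧ (u ≡ᵇ c)) ⟩
  b2n ((p ≡ᵇ m) ∧ (s ≡ᵇ a) ∧ (t ≡ᵇ b) ∧ (u ≡ᵇ c))
    ≡⟨ b2n-∧ (p ≡ᵇ m) _ ⟩
  b2n (p ≡ᵇ m) * b2n ((s ≡ᵇ a) ∧ (t ≡ᵇ b) ∧ (u ≡ᵇ c))
    ≡⟨ cong (b2n (p ≡ᵇ m) *_) (trans (b2n-∧ (s ≡ᵇ a) _) (cong (b2n (s ≡ᵇ a) *_) (b2n-∧ (t ≡ᵇ b) _))) ⟩
  b2n (p ≡ᵇ m) * (b2n (s ≡ᵇ a) * (b2n (t ≡ᵇ b) * b2n (u ≡ᵇ c)))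
    ∎

data Exponent : Set where
  q^_x^_y^_z^_ : ℕ → ℕ → ℕ → ℕ → Exponent

0ᴱ : Exponent
0ᴱ = q^ 0 x^ 0 y^ 0 z^ 0

infixl 6 _+ᴱ_
_+ᴱ_ : Exponent → Exponent → Exponent
(q^ m x^ a y^ b z^ c) +ᴱ (q^ m′ x^ a′ y^ b′ z^ c′) = q^ (m + m′) x^ (a + a′) y^ (b + b′) z^ (c + c′)

+ᴱ-assoc : ∀ e f g → e +ᴱ f +ᴱ g ≡ e +ᴱ (f +ᴱ g)
+ᴱ-assoc (q^ m x^ a y^ b z^ c) (q^ m′ x^ a′ y^ b′ z^ c′) (q^ m″ x^ a″ y^ b″ z^ c″)
  rewrite +-assoc m m′ m″ | +-assoc a a′ a″ | +-assoc b b′ b″ | +-assoc c c′ c″ = refl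

+ᴱ-identityʳ : ∀ e → e +ᴱ 0ᴱ ≡ e
+ᴱ-identityʳ (q^ m x^ a y^ b z^ c)
  rewrite +-identityʳ m | +-identityʳ a | +-identityʳ b | +-identityʳ c = refl

monomial : Exponent → Ser
monomial (q^ m x^ a y^ b z^ c) = mono m a b c

series : List Exponent → Ser
series []       = zeroˢ
series (e ∷ es) = monomial e ⊕ series es

≡⇒≗ˢ : ∀ {es fs} → es ≡ fs → series es ≗ˢ series fs
≡⇒≗ˢ refl m a b c = refl

series-++ : ∀ es fs → series (es ++ fs) ≗ˢ series es ⊕ series fs
series-++ []       fs m a b c = refl
series-++ (e ∷ es) fs m a b c =
  trans (cong (monomial e m a b c +_) (series-++ es fs m a b c)) (sym (+-assoc (monomial e m a b c) _ _))

divides : Exponent → ℕ → ℕ → ℕ → ℕ → ℕ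
divides (q^ p x^ s y^ t z^ u) m a b c = b2n (p ≤ᵇ m) * (b2n (s ≤ᵇ a) * (b2n (t ≤ᵇ b) * b2n (u ≤ᵇ c)))

-- Multiplication by the monomial e; the indicator discards the junk values of truncated subtraction.
shift : Exponent → Ser → Ser
shift e@(q^ p x^ s y^ t z^ u) G m a b c = divides e m a b c * G (m ∸ p) (a ∸ s) (b ∸ t) (c ∸ u)

mono-⊛ : ∀ p s t u G → mono p s t u ⊛ G ≗ˢ shift (q^ p x^ s y^ t z^ u) G
mono-⊛ p s t u G m a b c = begin
  (mono p s t u ⊛ G) m a b c
    ≡⟨ (sumTo-cong m λ m₁ → sumTo-cong a λ a₁ → sumTo-cong b (sift-z m₁ a₁)) ⟩
  sumTo m (λ m₁ → sumTo a λ a₁ → sumTo b λ b₁ → P m₁ * (X a₁ * (Y b₁ * (b2n (u ≤ᵇ c) * G′ m₁ a₁ b₁ u))))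
    ≡⟨ (sumTo-cong m λ m₁ → sumTo-cong a λ a₁ →
         sumTo-scale b (P m₁) (sumTo-scale b (X a₁) (sumTo-sift b t λ b₁ → b2n (u ≤ᵇ c) * G′ m₁ a₁ b₁ u))) ⟩
  sumTo m (λ m₁ → sumTo a λ a₁ → P m₁ * (X a₁ * (b2n (t ≤ᵇ b) * (b2n (u ≤ᵇ c) * G′ m₁ a₁ t u))))
    ≡⟨ (sumTo-cong m λ m₁ →
         sumTo-scale a (P m₁) (sumTo-sift a s λ a₁ → b2n (t ≤ᵇ b) * (b2n (u ≤ᵇ c) * G′ m₁ a₁ t u))) ⟩
  sumTo m (λ m₁ → P m₁ * (b2n (s ≤ᵇ a) * (b2n (t ≤ᵇ b) * (b2n (u ≤ᵇ c) * G′ m₁ s t u))))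
    ≡⟨ sumTo-sift m p (λ m₁ → b2n (s ≤ᵇ a) * (b2n (t ≤ᵇ b) * (b2n (u ≤ᵇ c) * G′ m₁ s t u))) ⟩
  b2n (p ≤ᵇ m) * (b2n (s ≤ᵇ a) * (b2n (t ≤ᵇ b) * (b2n (u ≤ᵇ c) * G′ p s t u)))
    ≡⟨ sym (*-assoc₅ (b2n (p ≤ᵇ m)) (b2n (s ≤ᵇ a)) (b2n (t ≤ᵇ b)) (b2n (u ≤ᵇ c)) (G′ p s t u)) ⟩
  shift (q^ p x^ s y^ t z^ u) G m a b c
    ∎
  where
  G′ : ℕ → ℕ → ℕ → ℕ → ℕ
  G′ m₁ a₁ b₁ c₁ = G (m ∸ m₁) (a ∸ a₁) (b ∸ b₁) (c ∸ c₁)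
  P X Y Z : ℕ → ℕ
  P m₁ = b2n (p ≡ᵇ m₁)
  X a₁ = b2n (s ≡ᵇ a₁)
  Y b₁ = b2n (t ≡ᵇ b₁)
  Z c₁ = b2n (u ≡ᵇ c₁)
  sift-z : ∀ m₁ a₁ b₁ → sumTo c (λ c₁ → mono p s t u m₁ a₁ b₁ c₁ * G′ m₁ a₁ b₁ c₁)
                          ≡ P m₁ * (X a₁ * (Y b₁ * (b2n (u ≤ᵇ c) * G′ m₁ a₁ b₁ u)))
  sift-z m₁ a₁ b₁ = begin
    sumTo c (λ c₁ → mono p s t u m₁ a₁ b₁ c₁ * G′ m₁ a₁ b₁ c₁)
      ≡⟨ (sumTo-cong c λ c₁ → trans (cong (_* G′ m₁ a₁ b₁ c₁) (mono-b2n p s t u m₁ a₁ b₁ c₁))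
                                     (*-assoc₅ (P m₁) (X a₁) (Y b₁) (Z c₁) (G′ m₁ a₁ b₁ c₁))) ⟩
    sumTo c (λ c₁ → P m₁ * (X a₁ * (Y b₁ * (Z c₁ * G′ m₁ a₁ b₁ c₁))))
      ≡⟨ sumTo-scale c (P m₁) (sumTo-scale c (X a₁) (sumTo-scale c (Y b₁) (sumTo-sift c u (G′ m₁ a₁ b₁)))) ⟩
    P m₁ * (X a₁ * (Y b₁ * (b2n (u ≤ᵇ c) * G′ m₁ a₁ b₁ u)))
      ∎

monomial-+ᴱ : ∀ e f → monomial (e +ᴱ f) ≗ˢ shift e (monomial f)
monomial-+ᴱ (q^ p x^ s y^ t z^ u) (q^ p′ x^ s′ y^ t′ z^ u′) m a b c = begin
  mono (p + p′) (s + s′) (t + t′) (u + u′) m a b c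
    ≡⟨ mono-b2n (p + p′) (s + s′) (t + t′) (u + u′) m a b c ⟩
  b2n (p + p′ ≡ᵇ m) * (b2n (s + s′ ≡ᵇ a) * (b2n (t + t′ ≡ᵇ b) * b2n (u + u′ ≡ᵇ c)))
    ≡⟨ cong₂ _*_ (b2n-+≡ᵇ p p′ m) (cong₂ _*_ (b2n-+≡ᵇ s s′ a) (cong₂ _*_ (b2n-+≡ᵇ t t′ b) (b2n-+≡ᵇ u u′ c))) ⟩
  (Q * Q′) * ((X * X′) * ((Y * Y′) * (Z * Z′)))
    ≡⟨ cong ((Q * Q′) *_) (trans (cong ((X * X′) *_) (*-interchange Y Y′ Z Z′)) (*-interchange X X′ _ _)) ⟩
  (Q * Q′) * ((X * (Y * Z)) * (X′ * (Y′ * Z′)))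
    ≡⟨ *-interchange Q Q′ _ _ ⟩
  (Q * (X * (Y * Z))) * (Q′ * (X′ * (Y′ * Z′)))
    ≡⟨ cong ((Q * (X * (Y * Z))) *_) (sym (mono-b2n p′ s′ t′ u′ (m ∸ p) (a ∸ s) (b ∸ t) (c ∸ u))) ⟩
  shift (q^ p x^ s y^ t z^ u) (mono p′ s′ t′ u′) m a b c
    ∎
  where
  Q = b2n (p ≤ᵇ m); Q′ = b2n (p′ ≡ᵇ m ∸ p)
  X = b2n (s ≤ᵇ a); X′ = b2n (s′ ≡ᵇ a ∸ s)
  Y = b2n (t ≤ᵇ b); Y′ = b2n (t′ ≡ᵇ b ∸ t)
  Z = b2n (u ≤ᵇ c); Z′ = b2n (u′ ≡ᵇ c ∸ u)

series-map-+ᴱ : ∀ e fs → series (map (e +ᴱ_) fs) ≗ˢ shift e (series fs)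
series-map-+ᴱ e@(q^ _ x^ _ y^ _ z^ _) []       m a b c = sym (*-zeroʳ (divides e m a b c))
series-map-+ᴱ e@(q^ _ x^ _ y^ _ z^ _) (f ∷ fs) m a b c =
  trans (cong₂ _+_ (monomial-+ᴱ e f m a b c) (series-map-+ᴱ e fs m a b c))
        (sym (*-distribˡ-+ (divides e m a b c) _ _))

infixl 7 _⊗_
_⊗_ : List Exponent → List Exponent → List Exponent
es ⊗ fs = concatMap (λ e → map (e +ᴱ_) fs) es

series-⊗ : ∀ es fs → series es ⊛ series fs ≗ˢ series (es ⊗ fs)
series-⊗ []                             fs = ⊛-zeroˡ (series fs)
series-⊗ (e@(q^ p x^ s y^ t z^ u) ∷ es) fs m a b c = begin
  ((monomial e ⊕ series es) ⊛ series fs) m a b c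
    ≡⟨ ⊛-distribʳ-⊕ (monomial e) (series es) (series fs) m a b c ⟩
  (mono p s t u ⊛ series fs) m a b c + (series es ⊛ series fs) m a b c
    ≡⟨ cong₂ _+_ (trans (mono-⊛ p s t u (series fs) m a b c) (sym (series-map-+ᴱ e fs m a b c)))
                 (series-⊗ es fs m a b c) ⟩
  series (map (e +ᴱ_) fs) m a b c + series (es ⊗ fs) m a b c
    ≡⟨ sym (series-++ (map (e +ᴱ_) fs) (es ⊗ fs) m a b c) ⟩
  series ((e ∷ es) ⊗ fs) m a b c
    ∎

⊗-congˡ : ∀ es fs fs′ → series fs ≗ˢ series fs′ → series (es ⊗ fs) ≗ˢ series (es ⊗ fs′)
⊗-congˡ es fs fs′ e =
  ≗ˢ-trans (≗ˢ-sym (series-⊗ es fs)) (≗ˢ-trans (⊛-cong {series es} (λ _ _ _ _ → refl) e) (series-⊗ es fs′))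

map-+ᴱ-⊗ : ∀ e fs gs → map (e +ᴱ_) fs ⊗ gs ≡ map (e +ᴱ_) (fs ⊗ gs)
map-+ᴱ-⊗ e []       gs = refl
map-+ᴱ-⊗ e (f ∷ fs) gs = begin
  map (e +ᴱ f +ᴱ_) gs ++ map (e +ᴱ_) fs ⊗ gs
    ≡⟨ cong₂ _++_ (trans (map-cong (+ᴱ-assoc e f) gs) (map-∘ gs)) (map-+ᴱ-⊗ e fs gs) ⟩
  map (e +ᴱ_) (map (f +ᴱ_) gs) ++ map (e +ᴱ_) (fs ⊗ gs)
    ≡⟨ sym (map-++ (e +ᴱ_) (map (f +ᴱ_) gs) (fs ⊗ gs)) ⟩
  map (e +ᴱ_) ((f ∷ fs) ⊗ gs)
    ∎

⊗-assoc : ∀ es fs gs → es ⊗ fs ⊗ gs ≡ es ⊗ (fs ⊗ gs)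
⊗-assoc []       fs gs = refl
⊗-assoc (e ∷ es) fs gs = begin
  (map (e +ᴱ_) fs ++ es ⊗ fs) ⊗ gs
    ≡⟨ concatMap-++ _ (map (e +ᴱ_) fs) (es ⊗ fs) ⟩
  map (e +ᴱ_) fs ⊗ gs ++ es ⊗ fs ⊗ gs
    ≡⟨ cong₂ _++_ (map-+ᴱ-⊗ e fs gs) (⊗-assoc es fs gs) ⟩
  (e ∷ es) ⊗ (fs ⊗ gs)
    ∎

⊗-identityˡ : ∀ es → (0ᴱ ∷ []) ⊗ es ≡ es
⊗-identityˡ es = trans (++-identityʳ _) (go es)
  where
  go : ∀ es → map (0ᴱ +ᴱ_) es ≡ es
  go []                         = refl
  go ((q^ _ x^ _ y^ _ z^ _) ∷ es) = cong (_ ∷_) (go es)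

⊗-identityʳ : ∀ es → es ⊗ (0ᴱ ∷ []) ≡ es
⊗-identityʳ []       = refl
⊗-identityʳ (e ∷ es) = cong₂ _∷_ (+ᴱ-identityʳ e) (⊗-identityʳ es)

factorExponents : ℕ → List Exponent
factorExponents j = (0ᴱ ∷ q^ (2 ^ j) x^ 1 y^ 0 z^ 0 ∷ [])
                  ⊗ (0ᴱ ∷ q^ (2 ^ j) x^ 0 y^ 1 z^ 0 ∷ q^ (2 * 2 ^ j) x^ 0 y^ 0 z^ 1 ∷ [])

factor≗series : ∀ j → factor j ≗ˢ series (factorExponents j)
factor≗series j = ≗ˢ-trans (⊛-cong first second)
  (series-⊗ (0ᴱ ∷ q^ (2 ^ j) x^ 1 y^ 0 z^ 0 ∷ []) (0ᴱ ∷ q^ (2 ^ j) x^ 0 y^ 1 z^ 0 ∷ q^ (2 * 2 ^ j) x^ 0 y^ 0 z^ 1 ∷ []))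
  where
  first : oneS ⊕ mono (2 ^ j) 1 0 0 ≗ˢ series (0ᴱ ∷ q^ (2 ^ j) x^ 1 y^ 0 z^ 0 ∷ [])
  first m a b c = cong (oneS m a b c +_) (sym (+-identityʳ _))
  second : oneS ⊕ mono (2 ^ j) 0 1 0 ⊕ mono (2 * 2 ^ j) 0 0 1
           ≗ˢ series (0ᴱ ∷ q^ (2 ^ j) x^ 0 y^ 1 z^ 0 ∷ q^ (2 * 2 ^ j) x^ 0 y^ 0 z^ 1 ∷ [])
  second m a b c = trans (+-assoc (oneS m a b c) _ _)
    (cong (λ w → oneS m a b c + (mono (2 ^ j) 0 1 0 m a b c + w)) (sym (+-identityʳ _)))

isOne isTwo : Fin 3 → ℕ
isOne (fsuc fzero)        = 1
isOne _                   = 0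
isTwo (fsuc (fsuc fzero)) = 1
isTwo _                   = 0

overlined singles doubles : {L : ℕ} → Vec Choice L → ℕ
overlined []            = 0
overlined ((o , c) ∷ v) = b2n o + overlined v
singles   []            = 0
singles   ((o , c) ∷ v) = isOne c + singles v
doubles   []            = 0
doubles   ((o , c) ∷ v) = isTwo c + doubles v

choiceExponent : ℕ → Choice → Exponent
choiceExponent j (o , c) = q^ ((b2n o + toℕ c) * 2 ^ j) x^ b2n o y^ isOne c z^ isTwo c

choiceExponents≡factorExponents : ∀ j → map (choiceExponent j) allChoices ≡ factorExponents j
choiceExponents≡factorExponents j = cong₂
  (λ w w′ → 0ᴱ ∷ q^ w x^ 0 y^ 1 z^ 0 ∷ q^ (2 * 2 ^ j) x^ 0 y^ 0 z^ 1
          ∷ q^ (2 ^ j + 0) x^ 1 y^ 0 z^ 0 ∷ q^ (2 ^ j + w′) x^ 1 y^ 1 z^ 0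
          ∷ q^ (3 * 2 ^ j) x^ 1 y^ 0 z^ 1 ∷ [])
  (*-identityˡ (2 ^ j)) (*-identityˡ (2 ^ j))

-- The term of ∏_{i ≥ j} factor i selected by a choice vector whose head describes the part 2^j.
exponentFrom : ℕ → {L : ℕ} → Vec Choice L → Exponent
exponentFrom j v = q^ weightFrom j v x^ overlined v y^ singles v z^ doubles v

exponentsFrom : ℕ → ℕ → List Exponent
exponentsFrom j L = map (exponentFrom j) (allVecs L)

exponentsFrom-suc : ∀ j L → exponentsFrom j (suc L) ≡ factorExponents j ⊗ exponentsFrom (suc j) L
exponentsFrom-suc j L = begin
  map (exponentFrom j) (concatMap (λ ch → map (ch ∷_) (allVecs L)) allChoices)
    ≡⟨ map-concatMap (exponentFrom j) (λ ch → map (ch ∷_) (allVecs L)) allChoices ⟩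
  concatMap (λ ch → map (exponentFrom j) (map (ch ∷_) (allVecs L))) allChoices
    ≡⟨ concatMap-cong pushHead allChoices ⟩
  concatMap (λ ch → map (choiceExponent j ch +ᴱ_) (exponentsFrom (suc j) L)) allChoices
    ≡⟨ sym (concatMap-map (λ e → map (e +ᴱ_) (exponentsFrom (suc j) L)) (choiceExponent j) allChoices) ⟩
  map (choiceExponent j) allChoices ⊗ exponentsFrom (suc j) L
    ≡⟨ cong (_⊗ exponentsFrom (suc j) L) (choiceExponents≡factorExponents j) ⟩
  factorExponents j ⊗ exponentsFrom (suc j) L
    ∎
  where
  head : ∀ ch (v : Vec Choice L) → exponentFrom j (ch ∷ v) ≡ choiceExponent j ch +ᴱ exponentFrom (suc j) v
  head (o , c) v = refl
  pushHead : ∀ ch → map (exponentFrom j) (map (ch ∷_) (allVecs L))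
                     ≡ map (choiceExponent j ch +ᴱ_) (exponentsFrom (suc j) L)
  pushHead ch = begin
    map (exponentFrom j) (map (ch ∷_) (allVecs L))
      ≡⟨ sym (map-∘ (allVecs L)) ⟩
    map (exponentFrom j ∘ (ch ∷_)) (allVecs L)
      ≡⟨ map-cong (head ch) (allVecs L) ⟩
    map ((choiceExponent j ch +ᴱ_) ∘ exponentFrom (suc j)) (allVecs L)
      ≡⟨ map-∘ (allVecs L) ⟩
    map (choiceExponent j ch +ᴱ_) (exponentsFrom (suc j) L)
      ∎

-- prodTo appends factors on the right, while allVecs conses choices on the left.
exponentsFrom-snoc : ∀ L j →
  series (exponentsFrom j (suc L)) ≗ˢ series (exponentsFrom j L ⊗ factorExponents (j + L))
exponentsFrom-snoc zero j rewrite +-identityʳ j = ≡⇒≗ˢ (begin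
  exponentsFrom j 1                      ≡⟨ exponentsFrom-suc j 0 ⟩
  factorExponents j ⊗ (0ᴱ ∷ [])          ≡⟨ ⊗-identityʳ _ ⟩
  factorExponents j                      ≡⟨ sym (⊗-identityˡ _) ⟩
  (0ᴱ ∷ []) ⊗ factorExponents j          ∎)
exponentsFrom-snoc (suc L) j rewrite +-suc j L =
  ≗ˢ-trans (≡⇒≗ˢ (exponentsFrom-suc j (suc L)))
  (≗ˢ-trans (⊗-congˡ (factorExponents j) (exponentsFrom (suc j) (suc L))
                      (exponentsFrom (suc j) L ⊗ factorExponents (suc j + L)) (exponentsFrom-snoc L (suc j)))
  (≡⇒≗ˢ (begin
    factorExponents j ⊗ (exponentsFrom (suc j) L ⊗ factorExponents (suc j + L))
      ≡⟨ sym (⊗-assoc (factorExponents j) (exponentsFrom (suc j) L) (factorExponents (suc j + L))) ⟩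
    factorExponents j ⊗ exponentsFrom (suc j) L ⊗ factorExponents (suc j + L)
      ≡⟨ cong (_⊗ factorExponents (suc j + L)) (sym (exponentsFrom-suc j L)) ⟩
    exponentsFrom j (suc L) ⊗ factorExponents (suc j + L)
      ∎)))

prodTo≗series : ∀ L → prodTo L ≗ˢ series (exponentsFrom 0 L)
prodTo≗series zero    m a b c = sym (+-identityʳ _)
prodTo≗series (suc L) =
  ≗ˢ-trans (⊛-cong (prodTo≗series L) (factor≗series L))
  (≗ˢ-trans (series-⊗ (exponentsFrom 0 L) (factorExponents L))
            (≗ˢ-sym (exponentsFrom-snoc L 0)))

diag : Ser → ℕ → ℕ → ℕ
diag F m k = sumTo k λ a → sumTo (k ∸ a) λ b → F m a b (k ∸ a ∸ b)

diag-cong : ∀ {F G} → F ≗ˢ G → ∀ m k → diag F m k ≡ diag G m k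
diag-cong e m k = sumTo-cong k λ a → sumTo-cong (k ∸ a) λ b → e m a b (k ∸ a ∸ b)

diag-⊕ : ∀ F G m k → diag (F ⊕ G) m k ≡ diag F m k + diag G m k
diag-⊕ F G m k = trans (sumTo-cong k λ a → sumTo-+ (k ∸ a) (λ b → F m a b (k ∸ a ∸ b)) (λ b → G m a b (k ∸ a ∸ b)))
                       (sumTo-+ k (λ a → sumTo (k ∸ a) λ b → F m a b (k ∸ a ∸ b))
                                  (λ a → sumTo (k ∸ a) λ b → G m a b (k ∸ a ∸ b)))

diag-zero : ∀ m k → diag zeroˢ m k ≡ 0
diag-zero m k = trans (sumTo-cong k λ a → sumTo-zero (k ∸ a)) (sumTo-zero k)

diag-mono : ∀ p s t u m k → diag (mono p s t u) m k ≡ b2n (p ≡ᵇ m) * b2n (s + (t + u) ≡ᵇ k)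
diag-mono p s t u m k = begin
  diag (mono p s t u) m k
    ≡⟨ (sumTo-cong k λ a → trans (sumTo-cong (k ∸ a) λ b → mono-b2n p s t u m a b (k ∸ a ∸ b))
         (sumTo-scale (k ∸ a) (b2n (p ≡ᵇ m)) (sumTo-scale (k ∸ a) (b2n (s ≡ᵇ a))
           (sumTo-sift (k ∸ a) t λ b → b2n (u ≡ᵇ k ∸ a ∸ b))))) ⟩
  sumTo k (λ a → b2n (p ≡ᵇ m) * (b2n (s ≡ᵇ a) * (b2n (t ≤ᵇ k ∸ a) * b2n (u ≡ᵇ k ∸ a ∸ t))))
    ≡⟨ sumTo-scale k (b2n (p ≡ᵇ m)) (sumTo-sift k s λ a → b2n (t ≤ᵇ k ∸ a) * b2n (u ≡ᵇ k ∸ a ∸ t)) ⟩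
  b2n (p ≡ᵇ m) * (b2n (s ≤ᵇ k) * (b2n (t ≤ᵇ k ∸ s) * b2n (u ≡ᵇ k ∸ s ∸ t)))
    ≡⟨ cong (b2n (p ≡ᵇ m) *_) (sym (trans (b2n-+≡ᵇ s (t + u) k) (cong (b2n (s ≤ᵇ k) *_) (b2n-+≡ᵇ t u (k ∸ s))))) ⟩
  b2n (p ≡ᵇ m) * b2n (s + (t + u) ≡ᵇ k)
    ∎

Sstat-split : ∀ {L} (v : Vec Choice L) → Sstat v ≡ overlined v + (singles v + doubles v)
Sstat-split []            = refl
Sstat-split ((o , c) ∷ v) = begin
  b2n o + occurs c + Sstat v
    ≡⟨ cong₂ (λ w w′ → b2n o + w + w′) (occurs-split c) (Sstat-split v) ⟩
  b2n o + (isOne c + isTwo c) + (overlined v + (singles v + doubles v))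
    ≡⟨ +-interchange (b2n o) _ _ _ ⟩
  b2n o + overlined v + ((isOne c + isTwo c) + (singles v + doubles v))
    ≡⟨ cong (b2n o + overlined v +_) (+-interchange (isOne c) _ _ _) ⟩
  b2n o + overlined v + (isOne c + singles v + (isTwo c + doubles v))
    ∎
  where
  occurs-split : ∀ c → occurs c ≡ isOne c + isTwo c
  occurs-split fzero               = refl
  occurs-split (fsuc fzero)        = refl
  occurs-split (fsuc (fsuc fzero)) = refl

length-filter-∷ : ∀ {A : Set} {P : A → Set} (P? : Decidable P) x xs →
  length (filter P? (x ∷ xs)) ≡ b2n (does (P? x)) + length (filter P? xs)
length-filter-∷ P? x xs with does (P? x)
... | true  = refl
... | false = refl

diag-series-count : ∀ m k {L} (vs : List (Vec Choice L)) →
  diag (series (map (exponentFrom 0) vs)) m k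
    ≡ length (filter (λ v → (weight v ≟ m) ×-dec (Sstat v ≟ k)) vs)
diag-series-count m k []       = diag-zero m k
diag-series-count m k (v ∷ vs) = begin
  diag (monomial (exponentFrom 0 v) ⊕ series (map (exponentFrom 0) vs)) m k
    ≡⟨ diag-⊕ (monomial (exponentFrom 0 v)) (series (map (exponentFrom 0) vs)) m k ⟩
  diag (mono (weight v) (overlined v) (singles v) (doubles v)) m k + diag (series (map (exponentFrom 0) vs)) m k
    ≡⟨ cong₂ _+_ (diag-mono (weight v) (overlined v) (singles v) (doubles v) m k) (diag-series-count m k vs) ⟩
  b2n (weight v ≡ᵇ m) * b2n (overlined v + (singles v + doubles v) ≡ᵇ k) + length (filter _ vs)
    ≡⟨ cong (λ s → b2n (weight v ≡ᵇ m) * b2n (s ≡ᵇ k) + length (filter _ vs)) (sym (Sstat-split v)) ⟩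
  b2n (weight v ≡ᵇ m) * b2n (Sstat v ≡ᵇ k) + length (filter _ vs)
    ≡⟨ cong (_+ length (filter _ vs)) (sym (b2n-∧ (weight v ≡ᵇ m) (Sstat v ≡ᵇ k))) ⟩
  b2n ((weight v ≡ᵇ m) ∧ (Sstat v ≡ᵇ k)) + length (filter _ vs)
    ≡⟨ sym (length-filter-∷ (λ v → (weight v ≟ m) ×-dec (Sstat v ≟ k)) v vs) ⟩
  length (filter (λ v → (weight v ≟ m) ×-dec (Sstat v ≟ k)) (v ∷ vs))
    ∎

pDiag≡countOP : ∀ m k → pDiag m k ≡ countOP m k
pDiag≡countOP m k =
  trans (diag-cong (prodTo≗series (suc m)) m k) (diag-series-count m k (allVecs (suc m)))

proposition5p4 : (n j : ℕ) → 1 ≤ n → j ≤ n → aCoeff n j ≡ countOP (2 ^ suc n ∸ 2) (n + j)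
proposition5p4 n j _ _ = pDiag≡countOP (2 ^ suc n ∸ 2) (n + j)
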